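{- In each of the algorithms \textsf{P}, \textsf{E}, \textsf{A}, \textsf{R}, \textsf{RA} (defined below), if the operations of a round preceding its \textsc{shortcut} (its connect operation and its update operation) change the parent of a vertex $v$ to $w$, then $w$ is green just before this change.
   Context: Each edge $e$ has two ends $e.v,e.w$; the current edge set is initially the input edge set. Each vertex $v$ has a parent $v.p$, initially $v$; $v$ is a root if $v.p=v$, otherwise $v$ is a child of $v.p$. The parent pointers form a forest; a leaf is a non-root with no children. Vertices are compared as integers. Each operation is performed simultaneously for all edges/vertices using values at the start of the operation. \textsc{connect}: for each edge $e$, send $\min\{e.v,e.w\}$ to $\max\{e.v,e.w\}$. \textsc{parent-connect}: for each edge $e$, let $x=e.v.p$, $y=e.w.p$; send $\min\{x,y\}$ to $\max\{x,y\}$. \textsc{extended-connect}: for each edge $e$, let $x=e.v.p$, $y=e.w.p$; if $y<x$ send $y$ to $e.v$ and to $x$, else send $x$ to $e.w$ and to $y$. \textsc{update}: for each vertex $v$, replace $v.p$ by the minimum of $v.p$ and the vertices sent to $v$ in the preceding connect operation. \textsc{root-update}: the same, but only for roots $v$. \textsc{shortcut}: for each vertex $v$, replace $v.p$ by $(v.p).p$. \textsc{alter}: for each edge $e$, let $x=e.v.p$, $y=e.w.p$; replace $e.v,e.w$ by $x,y$ (when $x=y$ the algorithm deletes the edge; for this analysis it is instead kept as the loop $(x,x)$, which does not affect any parent changes). Algorithms repeat a round until no parent changes: \textsf{P}: \textsc{parent-connect}; \textsc{update}; \textsc{shortcut}. \textsf{E}: \textsc{extended-connect}; \textsc{update}; \textsc{shortcut}.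 \textsf{A}: \textsc{connect}; \textsc{update}; \textsc{shortcut}; \textsc{alter}. \textsf{R}: \textsc{parent-connect}; \textsc{root-update}; \textsc{shortcut}. \textsf{RA}: \textsc{connect}; \textsc{root-update}; \textsc{shortcut}; \textsc{alter}. Colors: in \textsf{A} and \textsf{RA}, a vertex is green if it is a root or is an end of some current edge (loops included), and red otherwise; in \textsf{P}, \textsf{E}, \textsf{R}, a vertex is red if it is a leaf and green otherwise. -}

module Defs where

open import Data.Nat using (ℕ; zero; suc; _<_; _≤ᵇ_; _<ᵇ_)
open import Data.Fin using (Fin; toℕ)
open import Data.Fin.Properties using (_≟_)
open import Data.Bool using (Bool; true; false; if_then_else_)
open import Data.List using (List; []; _∷_; map; concatMap; foldr)
open import Data.List.Relation.Unary.Any using (Any)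
open import Data.Product using (_×_; _,_; proj₁; proj₂; Σ; ∃)
open import Data.Sum using (_⊎_)
open import Data.Empty using (⊥)
open import Relation.Nullary using (¬_; yes; no)
open import Relation.Binary.PropositionalEquality using (_≡_; _≢_)
open import Function using (_∘_)

data Alg : Set where
  P E A R RA : Alg

Vertex : ℕ → Set
Vertex n = Fin n

Edge : ℕ → Set
Edge n = Vertex n × Vertex n   -- e = (e.v , e.w)

-- Current state: parent pointers and current edge set (a list; loops kept).
record State (n : ℕ) : Set where
  constructor ⟨_,_⟩
  field
    par   : Vertex n → Vertex n
    edges : List (Edge n)
open State public

initial : ∀ {n} → List (Edge n) → State n
initial es = ⟨ (λ v → v) , es ⟩

minV maxV : ∀ {n} → Vertex n → Vertex n → Vertex n
minV a b = if toℕ a ≤ᵇ toℕ b then a else b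
maxV a b = if toℕ a ≤ᵇ toℕ b then b else a

-- A message (target , value): "send value to target".
Msg : ℕ → Set
Msg n = Vertex n × Vertex n

connectMsgs : ∀ {n} → State n → List (Msg n)
connectMsgs s = map (λ e → maxV (proj₁ e) (proj₂ e) , minV (proj₁ e) (proj₂ e)) (edges s)

parentConnectMsgs : ∀ {n} → State n → List (Msg n)
parentConnectMsgs s =
  map (λ e → let x = par s (proj₁ e) ; y = par s (proj₂ e) in (maxV x y , minV x y)) (edges s)

extendedConnectMsgs : ∀ {n} → State n → List (Msg n)
extendedConnectMsgs s = concatMap f (edges s)
  where
  f : _ → List (Msg _)
  f e = let x = par s (proj₁ e) ; y = par s (proj₂ e) in
        if toℕ y <ᵇ toℕ x
          then (proj₁ e , y) ∷ (x , y) ∷ []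
          else (proj₂ e , x) ∷ (y , x) ∷ []

msgs : ∀ {n} → Alg → State n → List (Msg n)
msgs P  = parentConnectMsgs
msgs E  = extendedConnectMsgs
msgs A  = connectMsgs
msgs R  = parentConnectMsgs
msgs RA = connectMsgs

minSent : ∀ {n} → List (Msg n) → Vertex n → Vertex n → Vertex n
minSent []             v a = a
minSent ((t , x) ∷ ms) v a with t ≟ v
... | yes _ = minV x (minSent ms v a)
... | no  _ = minSent ms v a

update : ∀ {n} → List (Msg n) → State n → State n
update ms s = ⟨ (λ v → minSent ms v (par s v)) , edges s ⟩

rootUpdate : ∀ {n} → List (Msg n) → State n → State n
rootUpdate ms s = ⟨ f , edges s ⟩
  where
  f : _ → _
  f v with par s v ≟ v
  ... | yes _ = minSent ms v (par s v)
  ... | no  _ = par s v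

updateOp : ∀ {n} → Alg → List (Msg n) → State n → State n
updateOp P  = update
updateOp E  = update
updateOp A  = update
updateOp R  = rootUpdate
updateOp RA = rootUpdate

connectUpdate : ∀ {n} → Alg → State n → State n
connectUpdate alg s = updateOp alg (msgs alg s) s

shortcut : ∀ {n} → State n → State n
shortcut s = ⟨ (λ v → par s (par s v)) , edges s ⟩

-- alter (edges with equal ends are kept as loops)
alter : ∀ {n} → State n → State n
alter s = ⟨ par s , map (λ e → par s (proj₁ e) , par s (proj₂ e)) (edges s) ⟩

round : ∀ {n} → Alg → State n → State n
round P  s = shortcut (connectUpdate P s)
round E  s = shortcut (connectUpdate E s)
round A  s = alter (shortcut (connectUpdate A s))
round R  s = shortcut (connectUpdate R s)
round RA s = alter (shortcut (connectUpdate RA s))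

after : ∀ {n} → Alg → ℕ → State n → State n
after alg zero    s = s
after alg (suc k) s = round alg (after alg k s)

ParentChanges : ∀ {n} → State n → State n → Set
ParentChanges s t = ∃ λ v → par s v ≢ par t v

-- round number (suc k) is executed: each of the rounds 1..k changed some parent
Executed : ∀ {n} → Alg → List (Edge n) → ℕ → Set
Executed alg es k =
  ∀ j → j < k → ParentChanges (after alg j (initial es)) (after alg (suc j) (initial es))

IsRoot : ∀ {n} → State n → Vertex n → Set
IsRoot s v = par s v ≡ v

IsLeaf : ∀ {n} → State n → Vertex n → Set
IsLeaf s v = ¬ IsRoot s v × (∀ u → par s u ≢ v)

IsEnd : ∀ {n} → State n → Vertex n → Set
IsEnd s v = Any (λ e → proj₁ e ≡ v ⊎ proj₂ e ≡ v) (edges s)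

Green : ∀ {n} → Alg → State n → Vertex n → Set
Green A  s v = IsRoot s v ⊎ IsEnd s v
Green RA s v = IsRoot s v ⊎ IsEnd s v
Green P  s v = ¬ IsLeaf s v
Green E  s v = ¬ IsLeaf s v
Green R  s v = ¬ IsLeaf s v

module Submission where

-- The operations of a round preceding its shortcut send a list
-- of messages (target , value) and then, for each vertex v that is updated,
-- replace v.p by the minimum of v.p and the values sent to v.  Since a
-- minimum is always one of its arguments, a parent that actually changes
-- becomes one of the sent values.  So it suffices to know a property of all
-- sent values that implies greenness:
--   * parent-connect and extended-connect only send current parents
--     (vertices of the form u.p), and a parent is never a leaf;
--   * connect only sends ends of current edges, which are green in A and RA.  The theorem combines these; it holds
-- in every state, so the hypothesis that the rounds were executed is unused.

open import Defs
open import Data.Nat using (ℕ; _≤ᵇ_; _<ᵇ_)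
open import Data.Fin using (toℕ)
open import Data.Fin.Properties using (_≟_)
open import Data.Bool using (true; false; if_then_else_)
open import Data.List using (List; []; _∷_)
open import Data.List.Relation.Unary.Any as Any using ()
open import Data.List.Relation.Unary.All using (All; []; _∷_; universal; tabulate)
open import Data.List.Relation.Unary.All.Properties using (map⁺; ++⁺)
open import Data.Product using (_,_; proj₁; proj₂; ∃)
open import Data.Sum using (_⊎_; inj₁; inj₂)
open import Data.Empty using (⊥-elim)
open import Relation.Nullary using (yes; no)
open import Relation.Binary.PropositionalEquality using (_≡_; _≢_; refl; sym; trans; subst)

minV-choice : ∀ {n} (x y : Vertex n) → minV x y ≡ x ⊎ minV x y ≡ y
minV-choice x y with toℕ x ≤ᵇ toℕ y
... | true  = inj₁ refl
... | false = inj₂ refl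

SentSatisfy : ∀ {n} → (Vertex n → Set) → List (Msg n) → Set
SentSatisfy Q ms = All (λ m → Q (proj₂ m)) ms

minSent-keeps-or-sends : ∀ {n} (Q : Vertex n → Set) (ms : List (Msg n)) →
  SentSatisfy Q ms → ∀ v a → minSent ms v a ≡ a ⊎ Q (minSent ms v a)
minSent-keeps-or-sends Q [] [] v a = inj₁ refl
minSent-keeps-or-sends Q ((t , x) ∷ ms) (qx ∷ qs) v a with t ≟ v
... | no _ = minSent-keeps-or-sends Q ms qs v a
... | yes _ with minV-choice x (minSent ms v a) | minSent-keeps-or-sends Q ms qs v a
...   | inj₁ took-x    | _            = inj₂ (subst Q (sym took-x) qx)
...   | inj₂ took-rest | inj₁ kept    = inj₁ (trans took-rest kept)
...   | inj₂ took-rest | inj₂ q-rest  = inj₂ (subst Q (sym took-rest) q-rest)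

updateOp-keeps-or-sends : ∀ {n} alg (Q : Vertex n → Set) (ms : List (Msg n)) (s : State n) →
  SentSatisfy Q ms → ∀ v → par (updateOp alg ms s) v ≡ par s v ⊎ Q (par (updateOp alg ms s) v)
updateOp-keeps-or-sends P  Q ms s qs v = minSent-keeps-or-sends Q ms qs v (par s v)
updateOp-keeps-or-sends E  Q ms s qs v = minSent-keeps-or-sends Q ms qs v (par s v)
updateOp-keeps-or-sends A  Q ms s qs v = minSent-keeps-or-sends Q ms qs v (par s v)
updateOp-keeps-or-sends R  Q ms s qs v = root-case
  where
  root-case : par (rootUpdate ms s) v ≡ par s v ⊎ Q (par (rootUpdate ms s) v)
  root-case with par s v ≟ v
  ... | yes _ = minSent-keeps-or-sends Q ms qs v (par s v)
  ... | no  _ = inj₁ refl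
updateOp-keeps-or-sends RA Q ms s qs v = updateOp-keeps-or-sends R Q ms s qs v

updateOp-sends : ∀ {n} alg (Q : Vertex n → Set) (ms : List (Msg n)) (s : State n) →
  SentSatisfy Q ms → ∀ v w → par s v ≢ w → par (updateOp alg ms s) v ≡ w → Q w
updateOp-sends alg Q ms s qs v w changed new with updateOp-keeps-or-sends alg Q ms s qs v
... | inj₁ kept = ⊥-elim (changed (trans (sym kept) new))
... | inj₂ q    = subst Q new q

IsParent : ∀ {n} → State n → Vertex n → Set
IsParent s w = ∃ λ u → par s u ≡ w

Sent : ∀ {n} → Alg → State n → Vertex n → Set
Sent P  = IsParent
Sent E  = IsParent
Sent R  = IsParent
Sent A  = IsEnd
Sent RA = IsEnd

minV-parent : ∀ {n} (s : State n) (e : Edge n) → IsParent s (minV (par s (proj₁ e)) (par s (proj₂ e)))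
minV-parent s (x , y) with minV-choice (par s x) (par s y)
... | inj₁ eq = x , sym eq
... | inj₂ eq = y , sym eq

parentConnect-sends-parents : ∀ {n} (s : State n) → SentSatisfy (IsParent s) (parentConnectMsgs s)
parentConnect-sends-parents s = map⁺ (universal (minV-parent s) (edges s))

extendedConnect-sends-parents : ∀ {n} (s : State n) → SentSatisfy (IsParent s) (extendedConnectMsgs s)
extendedConnect-sends-parents ⟨ p , [] ⟩          = []
extendedConnect-sends-parents ⟨ p , (x , y) ∷ es ⟩ =
  ++⁺ edge-sends-parents (extendedConnect-sends-parents ⟨ p , es ⟩)
  where
  edge-sends-parents : SentSatisfy (λ w → ∃ λ u → p u ≡ w)
    (if toℕ (p y) <ᵇ toℕ (p x) then (x , p y) ∷ (p x , p y) ∷ [] else (y , p x) ∷ (p y , p x) ∷ [])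
  edge-sends-parents with toℕ (p y) <ᵇ toℕ (p x)
  ... | true  = (y , refl) ∷ (y , refl) ∷ []
  ... | false = (x , refl) ∷ (x , refl) ∷ []

connect-sends-ends : ∀ {n} (s : State n) → SentSatisfy (IsEnd s) (connectMsgs s)
connect-sends-ends s = map⁺ (tabulate (λ e∈ → Any.map min-is-end e∈))
  where
  min-is-end : ∀ {e e′ : Edge _} → e ≡ e′ →
    proj₁ e′ ≡ minV (proj₁ e) (proj₂ e) ⊎ proj₂ e′ ≡ minV (proj₁ e) (proj₂ e)
  min-is-end {e = x , y} refl with minV-choice x y
  ... | inj₁ eq = inj₁ (sym eq)
  ... | inj₂ eq = inj₂ (sym eq)

sent-values : ∀ {n} alg (s : State n) → SentSatisfy (Sent alg s) (msgs alg s)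
sent-values P  s = parentConnect-sends-parents s
sent-values E  s = extendedConnect-sends-parents s
sent-values R  s = parentConnect-sends-parents s
sent-values A  s = connect-sends-ends s
sent-values RA s = connect-sends-ends s

-- Sent values are green: a parent has a child, so is not a leaf; in A and RA
-- an end of a current edge is green by definition.
sent-green : ∀ {n} alg (s : State n) w → Sent alg s w → Green alg s w
sent-green P  s w (u , pu≡w) (_ , childless) = childless u pu≡w
sent-green E  s w (u , pu≡w) (_ , childless) = childless u pu≡w
sent-green R  s w (u , pu≡w) (_ , childless) = childless u pu≡w
sent-green A  s w end = inj₂ end
sent-green RA s w end = inj₂ end

lemma6 : (alg : Alg) (n : ℕ) (es : List (Edge n)) (k : ℕ) →
         Executed alg es k →
         (v w : Vertex n) →
         par (after alg k (initial es)) v ≢ w →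
         par (connectUpdate alg (after alg k (initial es))) v ≡ w →
         Green alg (after alg k (initial es)) w
lemma6 alg n es k _ v w changed new =
  sent-green alg s w (updateOp-sends alg (Sent alg s) (msgs alg s) s (sent-values alg s) v w changed new)
  where
  s : State n
  s = after alg k (initial es)
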